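{- Let $\mathcal{M}=\langle S,N,V\rangle$ and $\mathcal{M}'=\langle S',N',V'\rangle$ be $c$-models. If $Z$ is a $c$-bisimulation between $\mathcal{M}$ and $\mathcal{M}'$, then $Z$ is an nbh-$\Delta$-bisimulation between $\mathcal{M}$ and $\mathcal{M}'$.
   Context: A neighborhood model is $\langle S,N,V\rangle$, $S\neq\emptyset$, $N:S\to 2^{2^S}$, $V:\mathbf{Prop}\to 2^S$; a $c$-model additionally satisfies $X\in N(s)\Rightarrow S\setminus X\in N(s)$. For $Z\subseteq S\times S'$, $(U,U')$ is $Z$-coherent if for all $(x,y)\in Z$, $x\in U$ iff $y\in U'$. A nonempty $Z$ is a $c$-bisimulation between $c$-models if for all $(s,s')\in Z$: $s\in V(p)$ iff $s'\in V'(p)$ for all $p$, and for every $Z$-coherent $(U,U')$, $U\in N(s)$ iff $U'\in N'(s')$. A nonempty $Z$ is an nbh-$\Delta$-bisimulation if for all $(s,s')\in Z$: $s\in V(p)$ iff $s'\in V'(p)$ for all $p$, and for every $Z$-coherent $(U,U')$: ($U\in N(s)$ or $S\setminus U\in N(s)$) iff ($U'\in N'(s')$ or $S'\setminus U'\in N'(s')$). -}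

module Defs where

open import Level using (Level; suc; _⊔_)
open import Data.Bool using (Bool; true; false; not)
open import Data.Product using (_×_; ∃)
open import Data.Sum using (_⊎_)
open import Relation.Binary.PropositionalEquality using (_≡_)
open import Function.Bundles using (_⇔_)

-- Subsets of a carrier S are characteristic functions S → Bool
-- (classical powerset 2^S).  Membership x ∈ U is U x ≡ true.
Subset : Set → Set
Subset S = S → Bool

_∈ₛ_ : {S : Set} → S → Subset S → Set
x ∈ₛ U = U x ≡ true

∁ : {S : Set} → Subset S → Subset S
∁ U x = not (U x)

_≐_ : {S : Set} → Subset S → Subset S → Set
U ≐ W = ∀ x → U x ≡ W x

-- A neighborhood model ⟨S, N, V⟩ over a set of propositional letters Prop.
-- N s is a set of subsets, given as a predicate on subsets; since subsets are
-- functions, we require that N s respects extensional equality of subsets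
-- (N s is a set of *sets*).
record NbhModel (Prop : Set) : Set₁ where
  field
    S        : Set
    inhabited : S
    N        : S → Subset S → Set
    V        : Prop → Subset S
    N-ext    : ∀ s {U W} → U ≐ W → N s U → N s W

IsCModel : {Prop : Set} → NbhModel Prop → Set
IsCModel M = ∀ s X → N s X → N s (∁ X)
  where open NbhModel M

module _ {Prop : Set} (M M' : NbhModel Prop) where
  private
    module M  = NbhModel M
    module M' = NbhModel M'

  Coherent : (Z : M.S → M'.S → Set) → Subset M.S → Subset M'.S → Set
  Coherent Z U U' = ∀ x y → Z x y → (x ∈ₛ U ⇔ y ∈ₛ U')

  NonEmptyRel : (Z : M.S → M'.S → Set) → Set
  NonEmptyRel Z = ∃ λ s → ∃ λ s' → Z s s'

  IsCBisim : (Z : M.S → M'.S → Set) → Set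
  IsCBisim Z =
    NonEmptyRel Z ×
    (∀ s s' → Z s s' →
       (∀ p → s ∈ₛ M.V p ⇔ s' ∈ₛ M'.V p) ×
       (∀ U U' → Coherent Z U U' → (M.N s U ⇔ M'.N s' U')))

  IsNbhΔBisim : (Z : M.S → M'.S → Set) → Set
  IsNbhΔBisim Z =
    NonEmptyRel Z ×
    (∀ s s' → Z s s' →
       (∀ p → s ∈ₛ M.V p ⇔ s' ∈ₛ M'.V p) ×
       (∀ U U' → Coherent Z U U' →
          ((M.N s U ⊎ M.N s (∁ U)) ⇔ (M'.N s' U' ⊎ M'.N s' (∁ U')))))

-- Coherence is closed under complementation, so a c-bisimulation already
-- matches the complements ∁ U, ∁ U' of every coherent pair; the two
-- equivalences for U and for ∁ U combine disjunct by disjunct.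
module Submission where

open import Defs
open import Data.Bool using (Bool; true; false; not)
open import Data.Product using (_,_)
open import Data.Sum.Function.Propositional using (_⊎-⇔_)
open import Relation.Binary.PropositionalEquality using (_≡_; refl)
open import Function.Bundles using (_⇔_; mk⇔; Equivalence)

not-cong-≡true-⇔ : ∀ {a b : Bool} → (a ≡ true ⇔ b ≡ true) → (not a ≡ true ⇔ not b ≡ true)
not-cong-≡true-⇔ {false} {false} _ = mk⇔ (λ _ → refl) (λ _ → refl)
not-cong-≡true-⇔ {true}  {true}  _ = mk⇔ (λ ()) (λ ())
not-cong-≡true-⇔ {true}  {false} a⇔b with Equivalence.to a⇔b refl
... | ()
not-cong-≡true-⇔ {false} {true}  a⇔b with Equivalence.from a⇔b refl
... | ()

module _ {Prop : Set} (M M' : NbhModel Prop) where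

  Coherent-∁ : ∀ {Z U U'} → Coherent M M' Z U U' → Coherent M M' Z (∁ U) (∁ U')
  Coherent-∁ coh x y xZy = not-cong-≡true-⇔ (coh x y xZy)

  IsCBisim⇒IsNbhΔBisim : ∀ {Z} → IsCBisim M M' Z → IsNbhΔBisim M M' Z
  IsCBisim⇒IsNbhΔBisim (nonempty , back-forth) = nonempty , λ s s' sZs' →
    let atoms , nbhs = back-forth s s' sZs'
    in atoms , λ U U' coh → nbhs U U' coh ⊎-⇔ nbhs (∁ U) (∁ U') (Coherent-∁ coh)

proposition6 : {Prop : Set} (M M' : NbhModel Prop) →
    IsCModel M → IsCModel M' →
    (Z : NbhModel.S M → NbhModel.S M' → Set) →
    IsCBisim M M' Z → IsNbhΔBisim M M' Z
proposition6 M M' _ _ _ = IsCBisim⇒IsNbhΔBisim M M'
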